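{- Let $G=(K_\ell,G^-,V_G)$ be a signed graph whose positive graph is complete, every vertex of which has a loop, and whose negative graph $G^-$ is threshold. Then any vertex $v$ for which $\deg_{G^- }(v)$ is minimal is signed simplicial. In particular, every vertex of $G$ is divisional.
   Context: A signed graph $G=(G^+,G^-,L_G)$ consists of simple graphs $G^+=(V_G,E_G^+)$, $G^-=(V_G,E_G^-)$ on a common finite vertex set and a loop set $L_G\subseteq V_G$; $\deg_{G^- }(v)$ is the number of negative edges at $v$. Threshold graphs: $K_1$ is threshold, and adding an isolated vertex or a dominating vertex (adjacent to all others) to a threshold graph gives a threshold graph. A vertex $v$ is signed simplicial if: (a) $\{u_1,v\},\{u_2,v\}\in E_G^+$ or both in $E_G^-$ (with $u_1\ne u_2$) implies $\{u_1,u_2\}\in E_G^+$; (b) $\{u_1,v\}\in E_G^+$, $\{u_2,v\}\in E_G^-$ (with $u_1\ne u_2$) implies $\{u_1,u_2\}\in E_G^-$; (c) if $\{u,v\}\in E_G^+\cup E_G^-$ and $v\in L_G$, or $\{u,v\}\in E_G^+\cap E_G^-$, then $u\in L_G$. Contraction of a positive edge $\{v,w\}$: $G/(v,w)$ has vertex set $V_G\setminus\{v\}$; positive edges those not containing $v$ plus $\{u,w\}$ for $u\ne w$ with $\{u,v\}\in E_G^+$; negative edges those not containing $v$ plus $\{u,w\}$ for $u\ne w$ with $\{u,v\}\in E_G^-$; loops $L_G\setminus\{v\}$ plus $w$ if $v\in L_G$ or $\{v,w\}\in E_G^-$; for a negative edge the new edges $\{u,w\}$ are positive when $\{u,v\}\in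 E_G^-$ and negative when $\{u,v\}\in E_G^+$, and $w$ gets a loop if $v\in L_G$ or $\{v,w\}\in E_G^+$. With $\Lambda_k=\{0,\pm1,\dots,\pm k\}$, a proper $k$-coloring is $\gamma:V_G\to\Lambda_k$ with $\gamma(u)\ne\gamma(v)$ on positive edges, $\gamma(u)\ne-\gamma(v)$ on negative edges, $\gamma(v)\ne0$ on loops; $\chi(G,t)$ satisfies $\chi(G,2k+1)=$ number of proper $k$-colorings for all $k\ge1$. An edge $\{v,w\}$ is divisional if $\chi(G/(v,w),t)$ divides $\chi(G,t)$; its endvertices are called divisional vertices. -}

module Defs where

open import Data.Bool using (Bool; true; false; _∧_; _∨_; not; if_then_else_)
open import Data.Bool.Properties using (∨-comm)
open import Data.Nat using (ℕ; zero; suc; _+_; _*_; _≤_)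
open import Data.Fin using (Fin; punchIn)
open import Data.Fin.Properties using (_≟_)
open import Data.Integer as ℤ using (ℤ; +_; -_)
open import Data.List using (List; []; _∷_; map; concatMap; allFin; foldr)
open import Data.Nat.ListAction using (sum)
open import Data.Vec using (Vec; []; _∷_; lookup)
open import Data.Product using (Σ; ∃; _×_; _,_)
open import Data.Sum using (_⊎_)
open import Relation.Nullary using (does; ¬_)
open import Relation.Binary.PropositionalEquality using (_≡_; refl; cong₂)

-- Signed graphs on the vertex set Fin n.
-- pos / neg : adjacency of the simple graphs G⁺ / G⁻ (symmetric, irreflexive)
-- loop      : characteristic function of the loop set L_G

record SignedGraph (n : ℕ) : Set where
  field
    pos     : Fin n → Fin n → Bool
    neg     : Fin n → Fin n → Bool
    loop    : Fin n → Bool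
    pos-sym : ∀ a b → pos a b ≡ pos b a
    neg-sym : ∀ a b → neg a b ≡ neg b a
    pos-irr : ∀ a → pos a a ≡ false
    neg-irr : ∀ a → neg a a ≡ false

open SignedGraph public

-- K₁ is threshold; G is threshold if it arises from a threshold graph by
-- adding an isolated or a dominating vertex x, i.e. G − x is threshold.

Isolated : ∀ {n} → (Fin n → Fin n → Bool) → Fin n → Set
Isolated E x = ∀ y → E x y ≡ false

Dominating : ∀ {n} → (Fin n → Fin n → Bool) → Fin n → Set
Dominating E x = ∀ y → ¬ (y ≡ x) → E x y ≡ true

data Threshold : (n : ℕ) → (Fin n → Fin n → Bool) → Set where
  K₁   : (E : Fin 1 → Fin 1 → Bool) → Threshold 1 E
  add  : ∀ {n} (E : Fin (suc n) → Fin (suc n) → Bool) (x : Fin (suc n)) →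
         Isolated E x ⊎ Dominating E x →
         Threshold n (λ a b → E (punchIn x a) (punchIn x b)) →
         Threshold (suc n) E

degNeg : ∀ {n} → SignedGraph n → Fin n → ℕ
degNeg {n} G v = sum (map (λ u → if neg G v u then 1 else 0) (allFin n))

SignedSimplicial : ∀ {n} → SignedGraph n → Fin n → Set
SignedSimplicial G v =
  (∀ u₁ u₂ → ¬ (u₁ ≡ u₂) →
     ((pos G u₁ v ≡ true × pos G u₂ v ≡ true) ⊎ (neg G u₁ v ≡ true × neg G u₂ v ≡ true)) →
     pos G u₁ u₂ ≡ true)
  × (∀ u₁ u₂ → ¬ (u₁ ≡ u₂) → pos G u₁ v ≡ true → neg G u₂ v ≡ true → neg G u₁ u₂ ≡ true)
  × (∀ u → (((pos G u v ≡ true ⊎ neg G u v ≡ true) × loop G v ≡ true)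
            ⊎ (pos G u v ≡ true × neg G u v ≡ true)) →
           loop G u ≡ true)

-- Contraction.  G/(v,w) lives on Fin n, the vertex a : Fin n standing for
-- punchIn v a : Fin (suc n) (i.e. all vertices except v, in order).

module Contraction {n : ℕ} (v w : Fin (suc n)) where

  isW : Fin (suc n) → Bool
  isW x = does (x ≟ w)

  new : (Fin (suc n) → Fin (suc n) → Bool) → Fin n → Fin n → Bool
  new F a b = isW (punchIn v a) ∧ (not (isW (punchIn v b)) ∧ F v (punchIn v b))

  merge : (E F : Fin (suc n) → Fin (suc n) → Bool) → Fin n → Fin n → Bool
  merge E F a b = E (punchIn v a) (punchIn v b) ∨ (new F a b ∨ new F b a)

  merge-sym : ∀ E F → (∀ x y → E x y ≡ E y x) → ∀ a b → merge E F a b ≡ merge E F b a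
  merge-sym E F s a b = cong₂ _∨_ (s (punchIn v a) (punchIn v b)) (∨-comm (new F a b) (new F b a))

  private
    lem : ∀ x y → x ∧ (not x ∧ y) ≡ false
    lem true y = refl
    lem false y = refl

  merge-irr : ∀ E F → (∀ x → E x x ≡ false) → ∀ a → merge E F a a ≡ false
  merge-irr E F i a rewrite i (punchIn v a)
    | lem (isW (punchIn v a)) (F v (punchIn v a)) = refl

_/⁺_ : ∀ {n} → SignedGraph (suc n) → Fin (suc n) × Fin (suc n) → SignedGraph n
G /⁺ (v , w) = record
  { pos = merge (pos G) (pos G)
  ; neg = merge (neg G) (neg G)
  ; loop = λ a → loop G (punchIn v a) ∨ (isW (punchIn v a) ∧ (loop G v ∨ neg G v w))
  ; pos-sym = merge-sym (pos G) (pos G) (pos-sym G)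
  ; neg-sym = merge-sym (neg G) (neg G) (neg-sym G)
  ; pos-irr = merge-irr (pos G) (pos G) (pos-irr G)
  ; neg-irr = merge-irr (neg G) (neg G) (neg-irr G)
  }
  where open Contraction v w

_/⁻_ : ∀ {n} → SignedGraph (suc n) → Fin (suc n) × Fin (suc n) → SignedGraph n
G /⁻ (v , w) = record
  { pos = merge (pos G) (neg G)
  ; neg = merge (neg G) (pos G)
  ; loop = λ a → loop G (punchIn v a) ∨ (isW (punchIn v a) ∧ (loop G v ∨ pos G v w))
  ; pos-sym = merge-sym (pos G) (neg G) (pos-sym G)
  ; neg-sym = merge-sym (neg G) (pos G) (neg-sym G)
  ; pos-irr = merge-irr (pos G) (neg G) (pos-irr G)
  ; neg-irr = merge-irr (neg G) (pos G) (neg-irr G)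
  }
  where open Contraction v w

Λ : ℕ → List ℤ
Λ zero    = + 0 ∷ []
Λ (suc k) = + suc k ∷ - (+ suc k) ∷ Λ k

colourings : (n k : ℕ) → List (Vec ℤ n)
colourings zero    k = [] ∷ []
colourings (suc n) k = concatMap (λ c → map (c ∷_) (colourings n k)) (Λ k)

allB : ∀ {A : Set} → (A → Bool) → List A → Bool
allB f = foldr (λ x r → f x ∧ r) true

infix 4 _≠ℤ_
_≠ℤ_ : ℤ → ℤ → Bool
x ≠ℤ y = not (does (x ℤ.≟ y))

proper : ∀ {n} → SignedGraph n → Vec ℤ n → Bool
proper {n} G γ = allB (λ a →
    (not (loop G a) ∨ (lookup γ a ≠ℤ (+ 0)))
    ∧ allB (λ b → (not (pos G a b) ∨ (lookup γ a ≠ℤ lookup γ b))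
                 ∧ (not (neg G a b) ∨ (lookup γ a ≠ℤ (- lookup γ b))))
           (allFin n))
  (allFin n)

numColourings : ∀ {n} → SignedGraph n → ℕ → ℕ
numColourings {n} G k = sum (map (λ γ → if proper G γ then 1 else 0) (colourings n k))

-- Integer polynomials as coefficient lists (constant term first)

Poly : Set
Poly = List ℤ

eval : Poly → ℤ → ℤ
eval []       x = + 0
eval (c ∷ cs) x = c ℤ.+ x ℤ.* eval cs x

-- polynomial divisibility Q ∣ P in ℤ[t] (equality of polynomials over ℤ is
-- equality of the induced functions ℤ → ℤ, ℤ being infinite)
_∣ₚ_ : Poly → Poly → Set
Q ∣ₚ P = ∃ λ R → ∀ x → eval P x ≡ eval Q x ℤ.* eval R x

IsChromaticPolynomial : ∀ {n} → SignedGraph n → Poly → Set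
IsChromaticPolynomial G P = ∀ k → 1 ≤ k → eval P (+ (2 * k + 1)) ≡ + numColourings G k

ChromDivides : ∀ {m n} → SignedGraph m → SignedGraph n → Set
ChromDivides H G = ∀ P Q → IsChromaticPolynomial G P → IsChromaticPolynomial H Q → Q ∣ₚ P

-- the edge {v,w} (contracted as G/(v,w), i.e. v is merged into w) is divisional
DivisionalEdge : ∀ {n} → SignedGraph (suc n) → Fin (suc n) → Fin (suc n) → Set
DivisionalEdge G v w =
  (pos G v w ≡ true × ChromDivides (G /⁺ (v , w)) G)
  ⊎ (neg G v w ≡ true × ChromDivides (G /⁻ (v , w)) G)

DivisionalVertex : ∀ {n} → SignedGraph (suc n) → Fin (suc n) → Set
DivisionalVertex G v = ∃ λ w → DivisionalEdge G v w ⊎ DivisionalEdge G w v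

-- Threshold graphs have nested neighbourhoods: if deg x ≤ deg y then every
-- neighbour z ≠ y of x is a neighbour of y.  For v of minimal negative degree
-- this is condition (b) of signed simpliciality; (a) and (c) hold by
-- completeness and the loops.  For divisionality contract the positive edge
-- {v,w}, w ≠ v: by nesting, G/(v,w) is just G − v, and a proper k-colouring
-- γ of G − v extends to G exactly by the colours of Λ_k outside the list
-- 0, γ(a) (all a), −γ(a) (a ∈ N⁻(v)), whose 1 + n + deg⁻ v entries are
-- distinct, again by nesting.  Hence χ(G,t) = (t − C)·χ(G/(v,w),t) at every
-- odd t ≥ 3, so as polynomials.  Every vertex lies on such an edge whose
-- other end is a fixed vertex of minimal negative degree.

module Submission where

open import Defs
open import Data.Bool using (Bool; true; false; if_then_else_; _∧_; _∨_; not)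
import Data.Bool.Properties as BoolP
open import Data.Bool.Properties using (∧-conicalˡ; ∧-conicalʳ)
open import Data.Empty using (⊥-elim)
open import Data.Fin using (Fin; punchIn; punchOut; fromℕ<) renaming (zero to fzero; suc to fsuc)
open import Data.Fin.Properties using (_≟_; punchIn-punchOut; punchInᵢ≢i; punchIn-injective)
open import Data.Integer as ℤ using (ℤ; -_) renaming (+_ to ⁺)
import Data.Integer.Properties as ℤP
open import Data.Integer.Tactic.RingSolver using (solve-∀)
open import Data.List using (List; []; _∷_; length; map; _++_; concatMap; tabulate; allFin; filter)
open import Data.List.Extrema.Nat using (argmin; f[argmin]≤f[xs])
open import Data.List.Membership.Propositional using (_∈_; _∉_)
open import Data.List.Membership.Propositional.Properties
  using (∈-concat⁻′; ∈-map⁺; ∈-map⁻; ∈-tabulate⁺; ∈-tabulate⁻; ∈-filter⁺; ∈-filter⁻; ∈-++⁺ˡ; ∈-++⁺ʳ; ∈-++⁻; ∈-allFin)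
open import Data.List.Properties using (length-tabulate; length-++; length-map)
import Data.List.Relation.Unary.All as All
open import Data.List.Relation.Unary.Any using (here; there)
open import Data.List.Relation.Unary.Unique.Propositional using (Unique; []; _∷_)
open import Data.List.Relation.Unary.Unique.Propositional.Properties
  using (Unique[x∷xs]⇒x∉xs; map⁺; ++⁺; filter⁺; tabulate⁺; allFin⁺)
open import Data.Nat using (ℕ; zero; suc; _+_; _*_; _≤_; _<_; s≤s; z≤n)
open import Data.Nat.ListAction using (sum)
import Data.Nat.Properties as ℕP
open import Algebra.Properties.CommutativeSemigroup ℕP.+-commutativeSemigroup
  using () renaming (interchange to +-interchange; x∙yz≈y∙xz to +-left-commute)
open import Data.Product using (_×_; _,_; proj₁; proj₂; ∃)
open import Data.Sum using (_⊎_; inj₁; inj₂)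
open import Data.Vec as Vec using (Vec; lookup; insertAt)
open import Data.Vec.Properties using (insertAt-lookup; insertAt-punchIn)
open import Function using (_∘_)
open import Relation.Binary using (DecidableEquality)
open import Relation.Binary.PropositionalEquality
open import Relation.Nullary using (¬_; yes; no; does)

open ≡-Reasoning

-- Polynomials over ℤ as coefficient lists.  The one algebraic fact needed
-- is: if P(s k) = Q(s k)·(s k − c) for infinitely many distinct points
-- s k, then P(t) = Q(t)·(t − c), so Q ∣ P.
module Polynomials where

  infixl 6 _+ₚ_

  _+ₚ_ : Poly → Poly → Poly
  []       +ₚ q        = q
  (a ∷ p)  +ₚ []       = a ∷ p
  (a ∷ p)  +ₚ (b ∷ q)  = (a ℤ.+ b) ∷ (p +ₚ q)

  eval-+ₚ : ∀ p q x → eval (p +ₚ q) x ≡ eval p x ℤ.+ eval q x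
  eval-+ₚ []      q       x = sym (ℤP.+-identityˡ _)
  eval-+ₚ (a ∷ p) []      x = sym (ℤP.+-identityʳ _)
  eval-+ₚ (a ∷ p) (b ∷ q) x = begin
    a ℤ.+ b ℤ.+ x ℤ.* eval (p +ₚ q) x             ≡⟨ cong (λ e → a ℤ.+ b ℤ.+ x ℤ.* e) (eval-+ₚ p q x) ⟩
    a ℤ.+ b ℤ.+ x ℤ.* (eval p x ℤ.+ eval q x)     ≡⟨ rearrange a b x (eval p x) (eval q x) ⟩
    a ℤ.+ x ℤ.* eval p x ℤ.+ (b ℤ.+ x ℤ.* eval q x) ∎
    where
    rearrange : ∀ a b x u v → a ℤ.+ b ℤ.+ x ℤ.* (u ℤ.+ v) ≡ a ℤ.+ x ℤ.* u ℤ.+ (b ℤ.+ x ℤ.* v)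
    rearrange = solve-∀

  scale : ℤ → Poly → Poly
  scale c = map (c ℤ.*_)

  eval-scale : ∀ c p x → eval (scale c p) x ≡ c ℤ.* eval p x
  eval-scale c []      x = sym (ℤP.*-zeroʳ c)
  eval-scale c (a ∷ p) x = begin
    c ℤ.* a ℤ.+ x ℤ.* eval (scale c p) x ≡⟨ cong (λ e → c ℤ.* a ℤ.+ x ℤ.* e) (eval-scale c p x) ⟩
    c ℤ.* a ℤ.+ x ℤ.* (c ℤ.* eval p x)   ≡⟨ distribute c a x (eval p x) ⟩
    c ℤ.* (a ℤ.+ x ℤ.* eval p x)         ∎
    where
    distribute : ∀ c a x u → c ℤ.* a ℤ.+ x ℤ.* (c ℤ.* u) ≡ c ℤ.* (a ℤ.+ x ℤ.* u)
    distribute = solve-∀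

  linear : ℤ → Poly
  linear c = - c ∷ ⁺ 1 ∷ []

  -- P(t) − (t − c)·Q(t), with (t − c)·Q(t) = t·Q(t) − c·Q(t)
  minusLinearMultiple : Poly → Poly → ℤ → Poly
  minusLinearMultiple P Q c = P +ₚ scale (- ⁺ 1) ((⁺ 0 ∷ Q) +ₚ scale (- c) Q)

  eval-minusLinearMultiple : ∀ P Q c x →
    eval (minusLinearMultiple P Q c) x ≡ eval P x ℤ.- eval Q x ℤ.* eval (linear c) x
  eval-minusLinearMultiple P Q c x = begin
    eval (P +ₚ scale (- ⁺ 1) ((⁺ 0 ∷ Q) +ₚ scale (- c) Q)) x
      ≡⟨ eval-+ₚ P (scale (- ⁺ 1) ((⁺ 0 ∷ Q) +ₚ scale (- c) Q)) x ⟩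
    eval P x ℤ.+ eval (scale (- ⁺ 1) ((⁺ 0 ∷ Q) +ₚ scale (- c) Q)) x
      ≡⟨ cong (λ e → eval P x ℤ.+ e) (eval-scale (- ⁺ 1) ((⁺ 0 ∷ Q) +ₚ scale (- c) Q) x) ⟩
    eval P x ℤ.+ - ⁺ 1 ℤ.* eval ((⁺ 0 ∷ Q) +ₚ scale (- c) Q) x
      ≡⟨ cong (λ e → eval P x ℤ.+ - ⁺ 1 ℤ.* e) (eval-+ₚ (⁺ 0 ∷ Q) (scale (- c) Q) x) ⟩
    eval P x ℤ.+ - ⁺ 1 ℤ.* (⁺ 0 ℤ.+ x ℤ.* eval Q x ℤ.+ eval (scale (- c) Q) x)
      ≡⟨ cong (λ e → eval P x ℤ.+ - ⁺ 1 ℤ.* (⁺ 0 ℤ.+ x ℤ.* eval Q x ℤ.+ e)) (eval-scale (- c) Q x) ⟩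
    eval P x ℤ.+ - ⁺ 1 ℤ.* (⁺ 0 ℤ.+ x ℤ.* eval Q x ℤ.+ - c ℤ.* eval Q x)
      ≡⟨ normalise (eval P x) (eval Q x) x c ⟩
    eval P x ℤ.- eval Q x ℤ.* (- c ℤ.+ x ℤ.* (⁺ 1 ℤ.+ x ℤ.* ⁺ 0)) ∎
    where
    normalise : ∀ p q x c → p ℤ.+ - ⁺ 1 ℤ.* (⁺ 0 ℤ.+ x ℤ.* q ℤ.+ - c ℤ.* q)
                          ≡ p ℤ.- q ℤ.* (- c ℤ.+ x ℤ.* (⁺ 1 ℤ.+ x ℤ.* ⁺ 0))
    normalise = solve-∀

  divideBy : ℤ → Poly → Poly × ℤ
  divideBy a []             = [] , ⁺ 0
  divideBy a (c ∷ [])       = [] , c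
  divideBy a (c ∷ p@(_ ∷ _)) =
    (proj₂ (divideBy a p) ∷ proj₁ (divideBy a p)) , c ℤ.+ a ℤ.* proj₂ (divideBy a p)

  quotient : ℤ → Poly → Poly
  quotient a p = proj₁ (divideBy a p)

  remainder : ℤ → Poly → ℤ
  remainder a p = proj₂ (divideBy a p)

  length-quotient : ∀ a c p → length (quotient a (c ∷ p)) ≡ length p
  length-quotient a c []      = refl
  length-quotient a c (d ∷ p) = cong suc (length-quotient a d p)

  division-law : ∀ a p x → eval p x ≡ remainder a p ℤ.+ (x ℤ.- a) ℤ.* eval (quotient a p) x
  division-law a []              x = empty x a
    where
    empty : ∀ x a → ⁺ 0 ≡ ⁺ 0 ℤ.+ (x ℤ.- a) ℤ.* ⁺ 0
    empty = solve-∀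
  division-law a (c ∷ [])        x = constant c x a
    where
    constant : ∀ c x a → c ℤ.+ x ℤ.* ⁺ 0 ≡ c ℤ.+ (x ℤ.- a) ℤ.* ⁺ 0
    constant = solve-∀
  division-law a (c ∷ p@(_ ∷ _)) x = begin
    c ℤ.+ x ℤ.* eval p x                 ≡⟨ cong (λ e → c ℤ.+ x ℤ.* e) (division-law a p x) ⟩
    c ℤ.+ x ℤ.* (r ℤ.+ (x ℤ.- a) ℤ.* q)     ≡⟨ horner c a x r q ⟩
    c ℤ.+ a ℤ.* r ℤ.+ (x ℤ.- a) ℤ.* (r ℤ.+ x ℤ.* q) ∎
    where
    r q : ℤ
    r = remainder a p
    q = eval (quotient a p) x
    horner : ∀ c a x r q → c ℤ.+ x ℤ.* (r ℤ.+ (x ℤ.- a) ℤ.* q)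
                         ≡ c ℤ.+ a ℤ.* r ℤ.+ (x ℤ.- a) ℤ.* (r ℤ.+ x ℤ.* q)
    horner = solve-∀

  -- Induction on the
  -- length: the remainder mod (t − s j) is P(s j) = 0, and the quotient
  -- vanishes at s k for k > j because s k − s j ≠ 0.
  module IdentityTheorem (s : ℕ → ℤ) (s-injective : ∀ {i j} → s i ≡ s j → i ≡ j) where

    vanishes : ∀ N p → length p ≡ N → ∀ j → (∀ k → j ≤ k → eval p (s k) ≡ ⁺ 0) →
               ∀ x → eval p x ≡ ⁺ 0
    vanishes zero    []        _   j zero-on x = refl
    vanishes (suc N) p@(c ∷ p′) len j zero-on x = begin
      eval p x                              ≡⟨ division-law a p x ⟩
      r ℤ.+ (x ℤ.- a) ℤ.* eval q x            ≡⟨ cong₂ (λ u v → u ℤ.+ (x ℤ.- a) ℤ.* v) r≡0 q-zero ⟩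
      ⁺ 0 ℤ.+ (x ℤ.- a) ℤ.* ⁺ 0               ≡⟨ cong (λ e → ⁺ 0 ℤ.+ e) (ℤP.*-zeroʳ (x ℤ.- a)) ⟩
      ⁺ 0                                   ∎
      where
      a : ℤ
      a = s j
      q : Poly
      q = quotient a p
      r : ℤ
      r = remainder a p
      difference : ∀ x → eval p x ℤ.- r ≡ (x ℤ.- a) ℤ.* eval q x
      difference x = begin
        eval p x ℤ.- r                          ≡⟨ cong (ℤ._- r) (division-law a p x) ⟩
        r ℤ.+ (x ℤ.- a) ℤ.* eval q x ℤ.- r        ≡⟨ cancel r ((x ℤ.- a) ℤ.* eval q x) ⟩
        (x ℤ.- a) ℤ.* eval q x                  ∎
        where
        cancel : ∀ r u → r ℤ.+ u ℤ.- r ≡ u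
        cancel = solve-∀
      r≡0 : r ≡ ⁺ 0
      r≡0 = begin
        r                                     ≡⟨ add-zero r (eval q a) a ⟩
        r ℤ.+ (a ℤ.- a) ℤ.* eval q a            ≡⟨ sym (division-law a p a) ⟩
        eval p a                              ≡⟨ zero-on j ℕP.≤-refl ⟩
        ⁺ 0                                   ∎
        where
        add-zero : ∀ r u a → r ≡ r ℤ.+ (a ℤ.- a) ℤ.* u
        add-zero = solve-∀
      q-zero-on : ∀ k → suc j ≤ k → eval q (s k) ≡ ⁺ 0
      q-zero-on k j<k with ℤP.i*j≡0⇒i≡0∨j≡0 (s k ℤ.- a) {eval q (s k)} product-zero
        where
        product-zero : (s k ℤ.- a) ℤ.* eval q (s k) ≡ ⁺ 0
        product-zero = begin
          (s k ℤ.- a) ℤ.* eval q (s k)          ≡⟨ sym (difference (s k)) ⟩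
          eval p (s k) ℤ.- r                    ≡⟨ cong₂ ℤ._-_ (zero-on k (ℕP.<⇒≤ j<k)) r≡0 ⟩
          ⁺ 0                                 ∎
      ... | inj₁ sk≡a = ⊥-elim (ℕP.<⇒≢ j<k (sym (s-injective (ℤP.i-j≡0⇒i≡j (s k) a sk≡a))))
      ... | inj₂ q≡0  = q≡0
      q-zero : eval q x ≡ ⁺ 0
      q-zero = vanishes N q (ℕP.suc-injective (trans (cong suc (length-quotient a c p′)) len))
                        (suc j) q-zero-on x

    linear-factor : ∀ P Q c j →
      (∀ k → j ≤ k → eval P (s k) ≡ eval Q (s k) ℤ.* (s k ℤ.- c)) → Q ∣ₚ P
    linear-factor P Q c j agree = linear c , λ x →
      ℤP.i-j≡0⇒i≡j _ _ (trans (sym (eval-minusLinearMultiple P Q c x))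
        (vanishes _ (minusLinearMultiple P Q c) refl j remainder-zero x))
      where
      remainder-zero : ∀ k → j ≤ k → eval (minusLinearMultiple P Q c) (s k) ≡ ⁺ 0
      remainder-zero k j≤k = begin
        eval (minusLinearMultiple P Q c) (s k)              ≡⟨ eval-minusLinearMultiple P Q c (s k) ⟩
        eval P (s k) ℤ.- eval Q (s k) ℤ.* eval (linear c) (s k)
          ≡⟨ cong (ℤ._- _) (agree k j≤k) ⟩
        eval Q (s k) ℤ.* (s k ℤ.- c) ℤ.- eval Q (s k) ℤ.* eval (linear c) (s k)
          ≡⟨ cancel (eval Q (s k)) (s k) c ⟩
        ⁺ 0                                         ∎
        where
        cancel : ∀ q x c → q ℤ.* (x ℤ.- c) ℤ.- q ℤ.* (- c ℤ.+ x ℤ.* (⁺ 1 ℤ.+ x ℤ.* ⁺ 0)) ≡ ⁺ 0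
        cancel = solve-∀

module FiniteSums where

  ⟦_⟧ : Bool → ℕ
  ⟦ b ⟧ = if b then 1 else 0

  sumOver : ∀ {A : Set} → List A → (A → ℕ) → ℕ
  sumOver L f = sum (map f L)

  sumOver-cong∈ : ∀ {A : Set} (L : List A) {f g : A → ℕ} → (∀ x → x ∈ L → f x ≡ g x) →
                  sumOver L f ≡ sumOver L g
  sumOver-cong∈ []      eq = refl
  sumOver-cong∈ (x ∷ L) eq = cong₂ _+_ (eq x (here refl)) (sumOver-cong∈ L (λ y y∈L → eq y (there y∈L)))

  sumOver-cong : ∀ {A : Set} (L : List A) {f g : A → ℕ} → (∀ x → f x ≡ g x) →
                 sumOver L f ≡ sumOver L g
  sumOver-cong L eq = sumOver-cong∈ L (λ x _ → eq x)

  sumOver-zero : ∀ {A : Set} (L : List A) → sumOver L (λ _ → 0) ≡ 0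
  sumOver-zero []      = refl
  sumOver-zero (x ∷ L) = sumOver-zero L

  sumOver-one : ∀ {A : Set} (L : List A) → sumOver L (λ _ → 1) ≡ length L
  sumOver-one []      = refl
  sumOver-one (x ∷ L) = cong suc (sumOver-one L)

  sumOver-+ : ∀ {A : Set} (L : List A) f g → sumOver L (λ x → f x + g x) ≡ sumOver L f + sumOver L g
  sumOver-+ []      f g = refl
  sumOver-+ (x ∷ L) f g = begin
    f x + g x + sumOver L (λ x → f x + g x)   ≡⟨ cong (f x + g x +_) (sumOver-+ L f g) ⟩
    f x + g x + (sumOver L f + sumOver L g)   ≡⟨ +-interchange (f x) (g x) _ _ ⟩
    f x + sumOver L f + (g x + sumOver L g)   ∎

  sumOver-*ʳ : ∀ {A : Set} (L : List A) f c → sumOver L (λ x → f x * c) ≡ sumOver L f * c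
  sumOver-*ʳ []      f c = refl
  sumOver-*ʳ (x ∷ L) f c = begin
    f x * c + sumOver L (λ x → f x * c)   ≡⟨ cong (f x * c +_) (sumOver-*ʳ L f c) ⟩
    f x * c + sumOver L f * c             ≡⟨ ℕP.*-distribʳ-+ c (f x) (sumOver L f) ⟨
    (f x + sumOver L f) * c               ∎

  sumOver-++ : ∀ {A : Set} (xs ys : List A) f → sumOver (xs ++ ys) f ≡ sumOver xs f + sumOver ys f
  sumOver-++ []       ys f = refl
  sumOver-++ (x ∷ xs) ys f = trans (cong (f x +_) (sumOver-++ xs ys f)) (sym (ℕP.+-assoc (f x) _ _))

  sumOver-map : ∀ {A B : Set} (L : List A) (g : A → B) f → sumOver (map g L) f ≡ sumOver L (λ x → f (g x))
  sumOver-map []      g f = refl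
  sumOver-map (x ∷ L) g f = cong (f (g x) +_) (sumOver-map L g f)

  sumOver-swap : ∀ {A B : Set} (M : List A) (L : List B) (g : A → B → ℕ) →
    sumOver M (λ a → sumOver L (g a)) ≡ sumOver L (λ b → sumOver M (λ a → g a b))
  sumOver-swap []      L g = sym (sumOver-zero L)
  sumOver-swap (a ∷ M) L g = begin
    sumOver L (g a) + sumOver M (λ a → sumOver L (g a))      ≡⟨ cong (sumOver L (g a) +_) (sumOver-swap M L g) ⟩
    sumOver L (g a) + sumOver L (λ b → sumOver M (λ a → g a b)) ≡⟨ sumOver-+ L (g a) _ ⟨
    sumOver L (λ b → g a b + sumOver M (λ a → g a b))         ∎

  sumFin : ∀ n → (Fin n → ℕ) → ℕ
  sumFin zero    h = 0
  sumFin (suc n) h = h fzero + sumFin n (λ i → h (fsuc i))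

  sumOver-tabulate : ∀ {A : Set} n (g : Fin n → A) f → sumOver (tabulate g) f ≡ sumFin n (λ i → f (g i))
  sumOver-tabulate zero    g f = refl
  sumOver-tabulate (suc n) g f = cong (f (g fzero) +_) (sumOver-tabulate n (λ i → g (fsuc i)) f)

  sumFin-punchIn : ∀ m (h : Fin (suc m) → ℕ) x → sumFin (suc m) h ≡ h x + sumFin m (λ i → h (punchIn x i))
  sumFin-punchIn m       h fzero    = refl
  sumFin-punchIn (suc m) h (fsuc x) = begin
    h fzero + sumFin (suc m) (λ i → h (fsuc i))
      ≡⟨ cong (h fzero +_) (sumFin-punchIn m (λ i → h (fsuc i)) x) ⟩
    h fzero + (h (fsuc x) + sumFin m (λ i → h (fsuc (punchIn x i))))
      ≡⟨ +-left-commute (h fzero) (h (fsuc x)) _ ⟩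
    h (fsuc x) + (h fzero + sumFin m (λ i → h (fsuc (punchIn x i)))) ∎

  count-≤ : ∀ n (b : Fin n → Bool) → sumFin n (λ i → ⟦ b i ⟧) ≤ n
  count-≤ zero    b = z≤n
  count-≤ (suc n) b with b fzero
  ... | true  = s≤s (count-≤ n (λ i → b (fsuc i)))
  ... | false = ℕP.m≤n⇒m≤1+n (count-≤ n (λ i → b (fsuc i)))

  count-all : ∀ n (b : Fin n → Bool) → (∀ i → b i ≡ true) → sumFin n (λ i → ⟦ b i ⟧) ≡ n
  count-all zero    b all = refl
  count-all (suc n) b all rewrite all fzero = cong suc (count-all n (λ i → b (fsuc i)) (λ i → all (fsuc i)))

  count-none : ∀ n (b : Fin n → Bool) → (∀ i → b i ≡ false) → sumFin n (λ i → ⟦ b i ⟧) ≡ 0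
  count-none zero    b none = refl
  count-none (suc n) b none rewrite none fzero = count-none n (λ i → b (fsuc i)) (λ i → none (fsuc i))

  count-< : ∀ n (b : Fin n → Bool) i → b i ≡ false → sumFin n (λ i → ⟦ b i ⟧) < n
  count-< (suc n) b i bi≡false = subst (_< suc n) (sym drop-i) (s≤s (count-≤ n (λ j → b (punchIn i j))))
    where
    drop-i : sumFin (suc n) (λ j → ⟦ b j ⟧) ≡ sumFin n (λ j → ⟦ b (punchIn i j) ⟧)
    drop-i = trans (sumFin-punchIn n (λ j → ⟦ b j ⟧) i) (cong (λ c → ⟦ c ⟧ + sumFin n (λ j → ⟦ b (punchIn i j) ⟧)) bi≡false)

  sumOver-cons : ∀ {A : Set} {n} (M : List A) (L : List (Vec A n)) f →
    sumOver (concatMap (λ c → map (c Vec.∷_) L) M) f ≡ sumOver M (λ c → sumOver L (λ γ → f (c Vec.∷ γ)))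
  sumOver-cons []      L f = refl
  sumOver-cons (c ∷ M) L f = trans (sumOver-++ (map (c Vec.∷_) L) _ f)
    (cong₂ _+_ (sumOver-map L (c Vec.∷_) f) (sumOver-cons M L f))

open FiniteSums

conflict : ∀ {A : Set} {b : Bool} → b ≡ true → b ≡ false → A
conflict refl ()

punchIn-view : ∀ {n} (x z : Fin (suc n)) → z ≡ x ⊎ ∃ λ z′ → z ≡ punchIn x z′
punchIn-view x z with z ≟ x
... | yes z≡x = inj₁ z≡x
... | no  z≢x = inj₂ (punchOut (z≢x ∘ sym) , sym (punchIn-punchOut (z≢x ∘ sym)))

-- Threshold graphs have nested neighbourhoods: N(x) ∖ {y} ⊆ N(y) whenever
-- deg x ≤ deg y.  Proof by induction along the construction, comparing
-- degrees with the added isolated or dominating vertex.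
module ThresholdGraphs where

  Adjacency : ℕ → Set
  Adjacency m = Fin m → Fin m → Bool

  Symmetric Irreflexive : ∀ {m} → Adjacency m → Set
  Symmetric   E = ∀ a b → E a b ≡ E b a
  Irreflexive E = ∀ a → E a a ≡ false

  deg : ∀ {m} → Adjacency m → Fin m → ℕ
  deg {m} E x = sumFin m (λ y → ⟦ E x y ⟧)

  _without_ : ∀ {m} → Adjacency (suc m) → Fin (suc m) → Adjacency m
  (E without x) a b = E (punchIn x a) (punchIn x b)

  deg-others : ∀ {m} (E : Adjacency (suc m)) → Irreflexive E → ∀ x →
               deg E x ≡ sumFin m (λ i → ⟦ E x (punchIn x i) ⟧)
  deg-others {m} E irr x = trans (sumFin-punchIn m (λ y → ⟦ E x y ⟧) x)
                                 (cong (λ b → ⟦ b ⟧ + sumFin m (λ i → ⟦ E x (punchIn x i) ⟧)) (irr x))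

  deg-dominating : ∀ {m} (E : Adjacency (suc m)) → Irreflexive E → ∀ x → Dominating E x → deg E x ≡ m
  deg-dominating {m} E irr x dom = trans (deg-others E irr x)
    (count-all m (λ i → E x (punchIn x i)) (λ i → dom (punchIn x i) (punchInᵢ≢i x i)))

  deg-missing : ∀ {m} (E : Adjacency (suc m)) → Irreflexive E → ∀ y z → ¬ (y ≡ z) → E y z ≡ false →
                deg E y < m
  deg-missing {m} E irr y z y≢z eyz = subst (_< m) (sym (deg-others E irr y))
    (count-< m (λ i → E y (punchIn y i)) (punchOut y≢z) (trans (cong (E y) (punchIn-punchOut y≢z)) eyz))

  deg-isolated : ∀ {m} (E : Adjacency m) x → Isolated E x → deg E x ≡ 0
  deg-isolated {m} E x iso = count-none m (E x) iso

  deg-positive : ∀ {m} (E : Adjacency (suc m)) x z → E x z ≡ true → 0 < deg E x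
  deg-positive {m} E x z exz rewrite sumFin-punchIn m (λ y → ⟦ E x y ⟧) z | exz = s≤s z≤n

  -- deleting an isolated or dominating vertex x₀ lowers every other degree
  -- by the same amount, so it preserves the degree order
  deg-order-without : ∀ {m} (E : Adjacency (suc m)) x₀ → Symmetric E → Isolated E x₀ ⊎ Dominating E x₀ →
    ∀ a b → deg E (punchIn x₀ a) ≤ deg E (punchIn x₀ b) → deg (E without x₀) a ≤ deg (E without x₀) b
  deg-order-without {m} E x₀ sym-E kind a b le =
    ℕP.+-cancelˡ-≤ ⟦ adjacent-to-x₀ kind ⟧ _ _ (subst₂ _≤_ (split a) (split b) le)
    where
    adjacent-to-x₀ : Isolated E x₀ ⊎ Dominating E x₀ → Bool
    adjacent-to-x₀ (inj₁ _) = false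
    adjacent-to-x₀ (inj₂ _) = true
    uniform : ∀ k c → E (punchIn x₀ c) x₀ ≡ adjacent-to-x₀ k
    uniform (inj₁ iso) c = trans (sym-E _ x₀) (iso (punchIn x₀ c))
    uniform (inj₂ dom) c = trans (sym-E _ x₀) (dom (punchIn x₀ c) (punchInᵢ≢i x₀ c))
    split : ∀ c → deg E (punchIn x₀ c) ≡ ⟦ adjacent-to-x₀ kind ⟧ + deg (E without x₀) c
    split c = trans (sumFin-punchIn m (λ y → ⟦ E (punchIn x₀ c) y ⟧) x₀)
                    (cong (λ e → ⟦ e ⟧ + deg (E without x₀) c) (uniform kind c))

  -- the three cases of the nesting lemma in which the added vertex x₀ is z, x or y
  nested-at-z : ∀ {m} (E : Adjacency m) x₀ → Symmetric E → Isolated E x₀ ⊎ Dominating E x₀ →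
                ∀ x y → E x x₀ ≡ true → ¬ (x₀ ≡ y) → E y x₀ ≡ true
  nested-at-z E x₀ sym-E (inj₁ iso) x y exx₀ _    = conflict exx₀ (trans (sym-E x x₀) (iso x))
  nested-at-z E x₀ sym-E (inj₂ dom) x y _    x₀≢y = trans (sym-E y x₀) (dom y (x₀≢y ∘ sym))

  nested-at-x : ∀ {m} (E : Adjacency (suc m)) x₀ → Irreflexive E → Isolated E x₀ ⊎ Dominating E x₀ →
                ∀ y z → deg E x₀ ≤ deg E y → E x₀ z ≡ true → ¬ (z ≡ y) → E y z ≡ true
  nested-at-x E x₀ irr (inj₁ iso) y z _  ex₀z _   = conflict ex₀z (iso z)
  nested-at-x E x₀ irr (inj₂ dom) y z le _   z≢y with E y z in eyz
  ... | true  = refl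
  ... | false = ⊥-elim (ℕP.<⇒≱ (deg-missing E irr y z (z≢y ∘ sym) eyz)
                                (subst (_≤ deg E y) (deg-dominating E irr x₀ dom) le))

  nested-at-y : ∀ {m} (E : Adjacency (suc m)) x₀ → Isolated E x₀ ⊎ Dominating E x₀ →
                ∀ x z → deg E x ≤ deg E x₀ → E x z ≡ true → ¬ (z ≡ x₀) → E x₀ z ≡ true
  nested-at-y E x₀ (inj₁ iso) x z le exz _    =
    ⊥-elim (ℕP.<⇒≱ (deg-positive E x z exz) (subst (deg E x ≤_) (deg-isolated E x₀ iso) le))
  nested-at-y E x₀ (inj₂ dom) x z _  _   z≢x₀ = dom z z≢x₀

  nested : ∀ {m} (E : Adjacency m) → Threshold m E → Symmetric E → Irreflexive E →
           ∀ x y z → deg E x ≤ deg E y → E x z ≡ true → ¬ (z ≡ y) → E y z ≡ true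
  nested E (K₁ .E) _ irr fzero y fzero _ exz _ = conflict exz (irr fzero)
  nested E (add .E x₀ kind smaller) sym-E irr x y z le exz z≢y
    with punchIn-view x₀ z | punchIn-view x₀ x | punchIn-view x₀ y
  ... | inj₁ refl | _ | _ = nested-at-z E x₀ sym-E kind x y exz z≢y
  ... | inj₂ _ | inj₁ refl | _ = nested-at-x E x₀ irr kind y z le exz z≢y
  ... | inj₂ _ | inj₂ _ | inj₁ refl = nested-at-y E x₀ kind x z le exz z≢y
  ... | inj₂ (z′ , refl) | inj₂ (x′ , refl) | inj₂ (y′ , refl) =
    nested (E without x₀) smaller (λ a b → sym-E _ _) (λ a → irr _) x′ y′ z′
           (deg-order-without E x₀ sym-E kind x′ y′ le) exz (λ z′≡y′ → z≢y (cong (punchIn x₀) z′≡y′))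

open ThresholdGraphs

module CountingOutside {A : Set} (_≟ᴬ_ : DecidableEquality A) where

  open import Data.List.Membership.DecPropositional _≟ᴬ_ using (_∈?_)

  count-absent : ∀ (L : List A) y → y ∉ L → sumOver L (λ c → ⟦ does (c ≟ᴬ y) ⟧) ≡ 0
  count-absent []      y _ = refl
  count-absent (x ∷ L) y y∉ with x ≟ᴬ y
  ... | yes refl = ⊥-elim (y∉ (here refl))
  ... | no  _    = count-absent L y (y∉ ∘ there)

  count-once : ∀ (L : List A) y → Unique L → y ∈ L → sumOver L (λ c → ⟦ does (c ≟ᴬ y) ⟧) ≡ 1
  count-once (x ∷ L) y uniq y∈ with x ≟ᴬ y
  ... | yes refl = cong suc (count-absent L x (Unique[x∷xs]⇒x∉xs uniq))
  count-once (x ∷ L) y _          (here y≡x) | no x≢y = ⊥-elim (x≢y (sym y≡x))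
  count-once (x ∷ L) y (_ ∷ uniq) (there y∈) | no _   = count-once L y uniq y∈

  membership-split : ∀ y F c → y ∉ F → ⟦ does (c ∈? (y ∷ F)) ⟧ ≡ ⟦ does (c ≟ᴬ y) ⟧ + ⟦ does (c ∈? F) ⟧
  membership-split y F c y∉F with c ≟ᴬ y
  ... | no  _    = refl
  ... | yes refl with c ∈? F
  ...   | yes c∈F = ⊥-elim (y∉F c∈F)
  ...   | no  _   = refl

  count-members : ∀ (L F : List A) → Unique L → Unique F → (∀ x → x ∈ F → x ∈ L) →
                  sumOver L (λ c → ⟦ does (c ∈? F) ⟧) ≡ length F
  count-members L []      _     _           _   = sumOver-zero L
  count-members L (y ∷ F) uL uF@(_ ∷ uF′) F⊆L = begin
    sumOver L (λ c → ⟦ does (c ∈? (y ∷ F)) ⟧)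
      ≡⟨ sumOver-cong L (λ c → membership-split y F c (Unique[x∷xs]⇒x∉xs uF)) ⟩
    sumOver L (λ c → ⟦ does (c ≟ᴬ y) ⟧ + ⟦ does (c ∈? F) ⟧)
      ≡⟨ sumOver-+ L _ _ ⟩
    sumOver L (λ c → ⟦ does (c ≟ᴬ y) ⟧) + sumOver L (λ c → ⟦ does (c ∈? F) ⟧)
      ≡⟨ cong₂ _+_ (count-once L y uL (F⊆L y (here refl))) (count-members L F uL uF′ (λ x → F⊆L x ∘ there)) ⟩
    suc (length F) ∎

  count-outside : ∀ (L F : List A) → Unique L → Unique F → (∀ x → x ∈ F → x ∈ L) →
    (p : A → Bool) → (∀ c → p c ≡ true → c ∉ F) → (∀ c → c ∉ F → p c ≡ true) →
    sumOver L (λ c → ⟦ p c ⟧) + length F ≡ length L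
  count-outside L F uL uF F⊆L p p⇒∉ ∉⇒p = begin
    sumOver L (λ c → ⟦ p c ⟧) + length F
      ≡⟨ cong (sumOver L (λ c → ⟦ p c ⟧) +_) (count-members L F uL uF F⊆L) ⟨
    sumOver L (λ c → ⟦ p c ⟧) + sumOver L (λ c → ⟦ does (c ∈? F) ⟧)
      ≡⟨ sumOver-+ L _ _ ⟨
    sumOver L (λ c → ⟦ p c ⟧ + ⟦ does (c ∈? F) ⟧)
      ≡⟨ sumOver-cong L exactly-one ⟩
    sumOver L (λ _ → 1)
      ≡⟨ sumOver-one L ⟩
    length L ∎
    where
    exactly-one : ∀ c → ⟦ p c ⟧ + ⟦ does (c ∈? F) ⟧ ≡ 1
    exactly-one c with p c in pc | c ∈? F
    ... | true  | yes c∈F = ⊥-elim (p⇒∉ c pc c∈F)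
    ... | true  | no  _   = refl
    ... | false | yes _   = refl
    ... | false | no c∉F  = conflict (∉⇒p c c∉F) pc

module Colours where

  Λ-bound : ∀ k x → x ∈ Λ k → ℤ.∣ x ∣ ≤ k
  Λ-bound zero    x (here refl)         = z≤n
  Λ-bound (suc k) x (here refl)         = ℕP.≤-refl
  Λ-bound (suc k) x (there (here refl)) = ℕP.≤-refl
  Λ-bound (suc k) x (there (there x∈))  = ℕP.m≤n⇒m≤1+n (Λ-bound k x x∈)

  Λ-unique : ∀ k → Unique (Λ k)
  Λ-unique zero    = All.[] ∷ []
  Λ-unique (suc k) = All.tabulate (λ x∈ → +k-fresh x∈ ∘ sym)
                   ∷ All.tabulate (λ x∈ → fresh x∈ ∘ sym) ∷ Λ-unique k
    where
    fresh : ∀ {x} → x ∈ Λ k → ¬ (x ≡ - ⁺ (suc k))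
    fresh x∈ refl = ℕP.<-irrefl refl (Λ-bound k _ x∈)
    +k-fresh : ∀ {x} → x ∈ - ⁺ (suc k) ∷ Λ k → ¬ (x ≡ ⁺ (suc k))
    +k-fresh (here refl) ()
    +k-fresh (there x∈)  refl = ℕP.<-irrefl refl (Λ-bound k _ x∈)

  Λ-neg : ∀ k x → x ∈ Λ k → - x ∈ Λ k
  Λ-neg zero    x (here refl)         = here refl
  Λ-neg (suc k) x (here refl)         = there (here refl)
  Λ-neg (suc k) x (there (here refl)) = here refl
  Λ-neg (suc k) x (there (there x∈))  = there (there (Λ-neg k x x∈))

  Λ-zero : ∀ k → ⁺ 0 ∈ Λ k
  Λ-zero zero    = here refl
  Λ-zero (suc k) = there (there (Λ-zero k))

  Λ-length : ∀ k → length (Λ k) ≡ 2 * k + 1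
  Λ-length zero    = refl
  Λ-length (suc k) = begin
    suc (suc (length (Λ k))) ≡⟨ cong (suc ∘ suc) (Λ-length k) ⟩
    suc (suc (2 * k + 1))    ≡⟨ cong (_+ 1) (ℕP.*-suc 2 k) ⟨
    2 * suc k + 1            ∎

  colourings-Λ : ∀ n k (γ : Vec ℤ n) → γ ∈ colourings n k → ∀ i → lookup γ i ∈ Λ k
  colourings-Λ (suc n) k γ γ∈ i with ∈-concat⁻′ (map (λ c → map (c Vec.∷_) (colourings n k)) (Λ k)) γ∈
  ... | _ , γ∈xs , xs∈ with ∈-map⁻ (λ c → map (c Vec.∷_) (colourings n k)) xs∈
  ...   | c , c∈ , refl with ∈-map⁻ (c Vec.∷_) γ∈xs | i
  ...     | _ , _ , refl | fzero  = c∈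
  ...     | γ′ , γ′∈ , refl | fsuc j = colourings-Λ n k γ′ γ′∈ j

  sumOver-colourings : ∀ n k (v : Fin (suc n)) (f : Vec ℤ (suc n) → ℕ) →
    sumOver (colourings (suc n) k) f ≡ sumOver (colourings n k) (λ γ → sumOver (Λ k) (λ c → f (insertAt γ v c)))
  sumOver-colourings n k fzero f = trans (sumOver-cons (Λ k) (colourings n k) f)
    (sumOver-swap (Λ k) (colourings n k) (λ c γ → f (c Vec.∷ γ)))
  sumOver-colourings (suc n) k (fsuc v) f = begin
    sumOver (colourings (suc (suc n)) k) f
      ≡⟨ sumOver-cons (Λ k) (colourings (suc n) k) f ⟩
    sumOver (Λ k) (λ c₀ → sumOver (colourings (suc n) k) (λ γ → f (c₀ Vec.∷ γ)))
      ≡⟨ sumOver-cong (Λ k) (λ c₀ → sumOver-colourings n k v (λ γ → f (c₀ Vec.∷ γ))) ⟩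
    sumOver (Λ k) (λ c₀ → sumOver (colourings n k) (λ γ → sumOver (Λ k) (λ c → f (c₀ Vec.∷ insertAt γ v c))))
      ≡⟨ sumOver-cons (Λ k) (colourings n k) (λ γ → sumOver (Λ k) (λ c → f (insertAt γ (fsuc v) c))) ⟨
    sumOver (colourings (suc n) k) (λ γ → sumOver (Λ k) (λ c → f (insertAt γ (fsuc v) c))) ∎

module ProperColourings where

  allB-tabulate⁻ : ∀ {A : Set} n (g : Fin n → A) f → allB f (tabulate g) ≡ true → ∀ i → f (g i) ≡ true
  allB-tabulate⁻ (suc n) g f all-f i with f (g fzero) in head | i
  ... | true | fzero  = head
  ... | true | fsuc j = allB-tabulate⁻ n (g ∘ fsuc) f all-f j

  allB-tabulate⁺ : ∀ {A : Set} n (g : Fin n → A) f → (∀ i → f (g i) ≡ true) → allB f (tabulate g) ≡ true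
  allB-tabulate⁺ zero    g f all-f = refl
  allB-tabulate⁺ (suc n) g f all-f rewrite all-f fzero = allB-tabulate⁺ n (g ∘ fsuc) f (all-f ∘ fsuc)

  implies⁻ : ∀ {a b} → not a ∨ b ≡ true → a ≡ true → b ≡ true
  implies⁻ a⇒b refl = a⇒b

  implies⁺ : ∀ {a b} → (a ≡ true → b ≡ true) → not a ∨ b ≡ true
  implies⁺ {true}  a⇒b = a⇒b refl
  implies⁺ {false} a⇒b = refl

  ≠ℤ⁻ : ∀ {x y} → (x ≠ℤ y) ≡ true → ¬ (x ≡ y)
  ≠ℤ⁻ {x} {y} x≠y x≡y with x ℤ.≟ y
  ... | no x≢y = x≢y x≡y

  ≠ℤ⁺ : ∀ {x y} → ¬ (x ≡ y) → (x ≠ℤ y) ≡ true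
  ≠ℤ⁺ {x} {y} x≢y with x ℤ.≟ y
  ... | yes x≡y = ⊥-elim (x≢y x≡y)
  ... | no  _   = refl

  loopTest : ∀ {n} → SignedGraph n → Vec ℤ n → Fin n → Bool
  loopTest G γ a = not (loop G a) ∨ (lookup γ a ≠ℤ ⁺ 0)

  edgeTest : ∀ {n} → SignedGraph n → Vec ℤ n → Fin n → Fin n → Bool
  edgeTest G γ a b = (not (pos G a b) ∨ (lookup γ a ≠ℤ lookup γ b))
                   ∧ (not (neg G a b) ∨ (lookup γ a ≠ℤ (- lookup γ b)))

  Proper : ∀ {n} → SignedGraph n → Vec ℤ n → Set
  Proper G γ =
      (∀ a → loop G a ≡ true → ¬ (lookup γ a ≡ ⁺ 0))
    × (∀ a b → pos G a b ≡ true → ¬ (lookup γ a ≡ lookup γ b))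
    × (∀ a b → neg G a b ≡ true → ¬ (lookup γ a ≡ - lookup γ b))

  proper⇒Proper : ∀ {n} (G : SignedGraph n) γ → proper G γ ≡ true → Proper G γ
  proper⇒Proper {n} G γ ok =
      (λ a → ≠ℤ⁻ ∘ implies⁻ (∧-conicalˡ _ _ (at a)))
    , (λ a b → ≠ℤ⁻ ∘ implies⁻ (∧-conicalˡ _ _ (at-edge a b)))
    , (λ a b → ≠ℤ⁻ ∘ implies⁻ (∧-conicalʳ _ _ (at-edge a b)))
    where
    at : ∀ a → loopTest G γ a ∧ allB (edgeTest G γ a) (allFin n) ≡ true
    at = allB-tabulate⁻ n (λ i → i) _ ok
    at-edge : ∀ a b → edgeTest G γ a b ≡ true
    at-edge a = allB-tabulate⁻ n (λ i → i) _ (∧-conicalʳ _ _ (at a))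

  Proper⇒proper : ∀ {n} (G : SignedGraph n) γ → Proper G γ → proper G γ ≡ true
  Proper⇒proper {n} G γ (loops , pos-edges , neg-edges) = allB-tabulate⁺ n (λ i → i) _ λ a →
    ∧-intro (implies⁺ (≠ℤ⁺ ∘ loops a)) (allB-tabulate⁺ n (λ i → i) _ λ b →
      ∧-intro (implies⁺ (≠ℤ⁺ ∘ pos-edges a b)) (implies⁺ (≠ℤ⁺ ∘ neg-edges a b)))
    where
    ∧-intro : ∀ {a b} → a ≡ true → b ≡ true → a ∧ b ≡ true
    ∧-intro refl refl = refl

  Valid : ∀ {n} → Adjacency n → Vec ℤ n → Set
  Valid E γ =
      (∀ a → ¬ (lookup γ a ≡ ⁺ 0))
    × (∀ a b → ¬ (a ≡ b) → ¬ (lookup γ a ≡ lookup γ b))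
    × (∀ a b → E a b ≡ true → ¬ (lookup γ a ≡ - lookup γ b))

  Valid-subgraph : ∀ {n} {E E′ : Adjacency n} → (∀ a b → E′ a b ≡ true → E a b ≡ true) →
               ∀ γ → Valid E γ → Valid E′ γ
  Valid-subgraph E′⊆E γ (nonzero , injective , opposite) = nonzero , injective , λ a b → opposite a b ∘ E′⊆E a b

  Complete AllLoops : ∀ {n} → SignedGraph n → Set
  Complete G = ∀ a b → ¬ (a ≡ b) → pos G a b ≡ true
  AllLoops G = ∀ a → loop G a ≡ true

  proper⇒Valid : ∀ {n} (G : SignedGraph n) → Complete G → AllLoops G →
                 ∀ γ → proper G γ ≡ true → Valid (neg G) γ
  proper⇒Valid G complete loops γ ok with proper⇒Proper G γ ok
  ... | at-loops , at-pos , at-neg = (λ a → at-loops a (loops a)) , (λ a b → at-pos a b ∘ complete a b) , at-neg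

  Valid⇒proper : ∀ {n} (G : SignedGraph n) γ → Valid (neg G) γ → proper G γ ≡ true
  Valid⇒proper G γ (nonzero , injective , opposite) = Proper⇒proper G γ
    ((λ a _ → nonzero a) , (λ a b ab → injective a b (λ { refl → conflict ab (pos-irr G a) })) , opposite)

open Colours
open ProperColourings

opposite-sym : ∀ (x y : ℤ) → x ≡ - y → y ≡ - x
opposite-sym x y refl = sym (ℤP.neg-involutive y)

self-opposite : ∀ (x : ℤ) → x ≡ - x → x ≡ ⁺ 0
self-opposite (⁺ zero)    _  = refl
self-opposite (⁺ (suc m)) ()
self-opposite ℤ.-[1+ m ]  ()

module Extension {n} (E : Adjacency (suc n)) (E-sym : Symmetric E) (E-irr : Irreflexive E)
                 (v : Fin (suc n)) where

  private
    p : Fin n → Fin (suc n)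
    p = punchIn v

  Free : Vec ℤ n → ℤ → Set
  Free γ′ c = ¬ (c ≡ ⁺ 0)
            × (∀ a → ¬ (c ≡ lookup γ′ a))
            × (∀ a → E v (p a) ≡ true → ¬ (c ≡ - lookup γ′ a))

  module _ (γ′ : Vec ℤ n) (c : ℤ) where

    private
      γ : Vec ℤ (suc n)
      γ = insertAt γ′ v c
      at-v : lookup γ v ≡ c
      at-v = insertAt-lookup γ′ v c
      at-p : ∀ a → lookup γ (p a) ≡ lookup γ′ a
      at-p a = insertAt-punchIn γ′ v c a

    Valid-insert⁻ : Valid E γ → Valid (E without v) γ′ × Free γ′ c
    Valid-insert⁻ (nonzero , injective , opposite) =
        ( (λ a → nonzero (p a) ∘ trans (at-p a))
        , (λ a b a≢b eq → injective (p a) (p b) (a≢b ∘ punchIn-injective v a b)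
                            (trans (at-p a) (trans eq (sym (at-p b)))))
        , (λ a b ab eq → opposite (p a) (p b) ab (trans (at-p a) (trans eq (cong -_ (sym (at-p b)))))) )
      , (nonzero v ∘ trans at-v)
      , (λ a eq → injective v (p a) (punchInᵢ≢i v a ∘ sym) (trans at-v (trans eq (sym (at-p a)))))
      , (λ a va eq → opposite v (p a) va (trans at-v (trans eq (cong -_ (sym (at-p a))))))

    Valid-insert⁺ : Valid (E without v) γ′ → Free γ′ c → Valid E γ
    Valid-insert⁺ (nonzero , injective , opposite) (c≢0 , c-new , c-not-opposite) =
      nonzero⁺ , injective⁺ , opposite⁺
      where
      nonzero⁺ : ∀ a → ¬ (lookup γ a ≡ ⁺ 0)
      nonzero⁺ a with punchIn-view v a
      ... | inj₁ refl        = c≢0 ∘ trans (sym at-v)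
      ... | inj₂ (a′ , refl) = nonzero a′ ∘ trans (sym (at-p a′))
      injective⁺ : ∀ a b → ¬ (a ≡ b) → ¬ (lookup γ a ≡ lookup γ b)
      injective⁺ a b a≢b with punchIn-view v a | punchIn-view v b
      ... | inj₁ refl        | inj₁ refl        = ⊥-elim (a≢b refl)
      ... | inj₁ refl        | inj₂ (b′ , refl) = λ eq → c-new b′ (trans (sym at-v) (trans eq (at-p b′)))
      ... | inj₂ (a′ , refl) | inj₁ refl        = λ eq → c-new a′ (trans (sym at-v) (trans (sym eq) (at-p a′)))
      ... | inj₂ (a′ , refl) | inj₂ (b′ , refl) = λ eq →
        injective a′ b′ (a≢b ∘ cong p) (trans (sym (at-p a′)) (trans eq (at-p b′)))
      opposite⁺ : ∀ a b → E a b ≡ true → ¬ (lookup γ a ≡ - lookup γ b)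
      opposite⁺ a b ab with punchIn-view v a | punchIn-view v b
      ... | inj₁ refl        | inj₁ refl        = conflict ab (E-irr v)
      ... | inj₁ refl        | inj₂ (b′ , refl) = λ eq →
        c-not-opposite b′ ab (trans (sym at-v) (trans eq (cong -_ (at-p b′))))
      ... | inj₂ (a′ , refl) | inj₁ refl        = λ eq →
        c-not-opposite a′ (trans (E-sym v (p a′)) ab) (trans (sym at-v) (opposite-sym _ _ (trans (sym (at-p a′)) eq)))
      ... | inj₂ (a′ , refl) | inj₂ (b′ , refl) = λ eq →
        opposite a′ b′ ab (trans (sym (at-p a′)) (trans eq (cong -_ (at-p b′))))

  SmallestNeighbourhood : Set
  SmallestNeighbourhood = ∀ a b → E v (p b) ≡ true → ¬ (a ≡ b) → E (p a) (p b) ≡ true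

  neighbours : List (Fin n)
  neighbours = filter (λ a → E v (p a) BoolP.≟ true) (allFin n)

  neighbour⁻ : ∀ {a} → a ∈ neighbours → E v (p a) ≡ true
  neighbour⁻ a∈ = proj₂ (∈-filter⁻ (λ a → E v (p a) BoolP.≟ true) {xs = allFin n} a∈)

  neighbour⁺ : ∀ {a} → E v (p a) ≡ true → a ∈ neighbours
  neighbour⁺ {a} = ∈-filter⁺ (λ a → E v (p a) BoolP.≟ true) (∈-allFin a)

  length-neighbours : length neighbours ≡ deg E v
  length-neighbours = trans (length-filter (allFin n)) (trans (sumOver-tabulate n (λ a → a) _) (sym (deg-others E E-irr v)))
    where
    length-filter : ∀ (as : List (Fin n)) →
      length (filter (λ a → E v (p a) BoolP.≟ true) as) ≡ sumOver as (λ a → ⟦ E v (p a) ⟧)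
    length-filter []       = refl
    length-filter (a ∷ as) with E v (p a)
    ... | true  = cong suc (length-filter as)
    ... | false = length-filter as

  forbidden : Vec ℤ n → List ℤ
  forbidden γ′ = ⁺ 0 ∷ tabulate (lookup γ′) ++ map (-_ ∘ lookup γ′) neighbours

  length-forbidden : ∀ γ′ → length (forbidden γ′) ≡ suc (n + deg E v)
  length-forbidden γ′ = cong suc (trans (length-++ (tabulate (lookup γ′)))
    (cong₂ _+_ (length-tabulate (lookup γ′)) (trans (length-map (-_ ∘ lookup γ′) neighbours) length-neighbours)))

  Free⇒∉forbidden : ∀ γ′ c → Free γ′ c → c ∉ forbidden γ′
  Free⇒∉forbidden γ′ c (c≢0 , c-new , c-not-opposite) (here c≡0) = c≢0 c≡0
  Free⇒∉forbidden γ′ c (c≢0 , c-new , c-not-opposite) (there c∈) with ∈-++⁻ (tabulate (lookup γ′)) c∈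
  ... | inj₁ c∈values with ∈-tabulate⁻ c∈values
  ...   | a , c≡γ′a = c-new a c≡γ′a
  Free⇒∉forbidden γ′ c (c≢0 , c-new , c-not-opposite) (there c∈) | inj₂ c∈opposites
    with ∈-map⁻ (-_ ∘ lookup γ′) c∈opposites
  ... | a , a∈ , c≡-γ′a = c-not-opposite a (neighbour⁻ a∈) c≡-γ′a

  ∉forbidden⇒Free : ∀ γ′ c → c ∉ forbidden γ′ → Free γ′ c
  ∉forbidden⇒Free γ′ c c∉ =
      (c∉ ∘ here)
    , (λ { a refl → c∉ (there (∈-++⁺ˡ (∈-tabulate⁺ a))) })
    , (λ { a va refl → c∉ (there (∈-++⁺ʳ (tabulate (lookup γ′))
           (∈-map⁺ (-_ ∘ lookup γ′) (neighbour⁺ va)))) })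

  forbidden-unique : SmallestNeighbourhood →
                     ∀ γ′ → Valid (E without v) γ′ → Unique (forbidden γ′)
  forbidden-unique smallest γ′ (nonzero , injective , opposite) =
    All.tabulate 0∉ ∷ ++⁺ (tabulate⁺ injective′) (map⁺ (injective′ ∘ ℤP.neg-injective) (filter⁺ _ (allFin⁺ n))) disjoint
    where
    injective′ : ∀ {a b} → lookup γ′ a ≡ lookup γ′ b → a ≡ b
    injective′ {a} {b} eq with a ≟ b
    ... | yes a≡b = a≡b
    ... | no  a≢b = ⊥-elim (injective a b a≢b eq)
    disjoint : ∀ {x} → ¬ (x ∈ tabulate (lookup γ′) × x ∈ map (-_ ∘ lookup γ′) neighbours)
    disjoint (x∈values , x∈opposites) with ∈-tabulate⁻ x∈values | ∈-map⁻ (-_ ∘ lookup γ′) x∈opposites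
    ... | a , refl | b , b∈ , γ′a≡-γ′b with a ≟ b
    ...   | yes refl = nonzero a (self-opposite _ γ′a≡-γ′b)
    ...   | no  a≢b  = opposite a b (smallest a b (neighbour⁻ b∈) a≢b) γ′a≡-γ′b
    0∉ : ∀ {x} → x ∈ tabulate (lookup γ′) ++ map (-_ ∘ lookup γ′) neighbours → ¬ (⁺ 0 ≡ x)
    0∉ x∈ refl with ∈-++⁻ (tabulate (lookup γ′)) x∈
    ... | inj₁ x∈values with ∈-tabulate⁻ x∈values
    ...   | a , 0≡γ′a = nonzero a (sym 0≡γ′a)
    0∉ x∈ refl | inj₂ x∈opposites with ∈-map⁻ (-_ ∘ lookup γ′) x∈opposites
    ... | a , _ , 0≡-γ′a = nonzero a (opposite-sym _ _ 0≡-γ′a)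

  forbidden-Λ : ∀ k γ′ → (∀ i → lookup γ′ i ∈ Λ k) → ∀ x → x ∈ forbidden γ′ → x ∈ Λ k
  forbidden-Λ k γ′ γ′∈Λ x (here refl) = Λ-zero k
  forbidden-Λ k γ′ γ′∈Λ x (there x∈) with ∈-++⁻ (tabulate (lookup γ′)) x∈
  ... | inj₁ x∈values with ∈-tabulate⁻ x∈values
  ...   | a , refl = γ′∈Λ a
  forbidden-Λ k γ′ γ′∈Λ x (there x∈) | inj₂ x∈opposites with ∈-map⁻ (-_ ∘ lookup γ′) x∈opposites
  ... | a , _ , refl = Λ-neg k _ (γ′∈Λ a)

  count-free : SmallestNeighbourhood →
    ∀ k γ′ → Valid (E without v) γ′ → (∀ i → lookup γ′ i ∈ Λ k) →
    (free? : ℤ → Bool) → (∀ c → free? c ≡ true → Free γ′ c) → (∀ c → Free γ′ c → free? c ≡ true) →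
    sumOver (Λ k) (λ c → ⟦ free? c ⟧) + suc (n + deg E v) ≡ 2 * k + 1
  count-free smallest k γ′ valid γ′∈Λ free? sound complete = begin
    sumOver (Λ k) (λ c → ⟦ free? c ⟧) + suc (n + deg E v)
      ≡⟨ cong (sumOver (Λ k) (λ c → ⟦ free? c ⟧) +_) (length-forbidden γ′) ⟨
    sumOver (Λ k) (λ c → ⟦ free? c ⟧) + length (forbidden γ′)
      ≡⟨ CountingOutside.count-outside ℤ._≟_ (Λ k) (forbidden γ′) (Λ-unique k)
           (forbidden-unique smallest γ′ valid) (forbidden-Λ k γ′ γ′∈Λ) free?
           (λ c → Free⇒∉forbidden γ′ c ∘ sound c) (λ c → complete c ∘ ∉forbidden⇒Free γ′ c) ⟩
    length (Λ k)
      ≡⟨ Λ-length k ⟩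
    2 * k + 1 ∎

chromatic-linear-factor : ∀ {m n} (G : SignedGraph m) (H : SignedGraph n) C →
  (∀ k → numColourings G k + numColourings H k * C ≡ numColourings H k * (2 * k + 1)) →
  ChromDivides H G
chromatic-linear-factor G H C counts P Q χG χH =
  linear-factor P Q (⁺ C) 1 λ k 1≤k → begin
    eval P (odd k)                     ≡⟨ χG k 1≤k ⟩
    ⁺ (#G k)                           ≡⟨ integral-counts k ⟩
    ⁺ (#H k) ℤ.* (odd k ℤ.- ⁺ C)       ≡⟨ cong (ℤ._* (odd k ℤ.- ⁺ C)) (χH k 1≤k) ⟨
    eval Q (odd k) ℤ.* (odd k ℤ.- ⁺ C) ∎
  where
  odd : ℕ → ℤ
  odd k = ⁺ (2 * k + 1)
  odd-injective : ∀ {i j} → odd i ≡ odd j → i ≡ j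
  odd-injective {i} {j} eq = ℕP.*-cancelˡ-≡ i j 2 (ℕP.+-cancelʳ-≡ _ _ _ (ℤP.+-injective eq))
  open Polynomials.IdentityTheorem odd odd-injective using (linear-factor)
  #G #H : ℕ → ℕ
  #G = numColourings G
  #H = numColourings H
  integral-counts : ∀ k → ⁺ (#G k) ≡ ⁺ (#H k) ℤ.* (odd k ℤ.- ⁺ C)
  integral-counts k = begin
    ⁺ (#G k)                                          ≡⟨ add-sub (⁺ (#G k)) (⁺ (#H k) ℤ.* ⁺ C) ⟩
    ⁺ (#G k) ℤ.+ ⁺ (#H k) ℤ.* ⁺ C ℤ.- ⁺ (#H k) ℤ.* ⁺ C ≡⟨ cong (ℤ._- ⁺ (#H k) ℤ.* ⁺ C) counts-in-ℤ ⟩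
    ⁺ (#H k) ℤ.* odd k ℤ.- ⁺ (#H k) ℤ.* ⁺ C            ≡⟨ factor-out (⁺ (#H k)) (odd k) (⁺ C) ⟩
    ⁺ (#H k) ℤ.* (odd k ℤ.- ⁺ C)                      ∎
    where
    counts-in-ℤ : ⁺ (#G k) ℤ.+ ⁺ (#H k) ℤ.* ⁺ C ≡ ⁺ (#H k) ℤ.* odd k
    counts-in-ℤ = begin
      ⁺ (#G k) ℤ.+ ⁺ (#H k) ℤ.* ⁺ C ≡⟨ cong (ℤ._+_ (⁺ (#G k))) (ℤP.pos-* (#H k) C) ⟨
      ⁺ (#G k) ℤ.+ ⁺ (#H k * C)     ≡⟨ ℤP.pos-+ (#G k) (#H k * C) ⟨
      ⁺ (#G k + #H k * C)           ≡⟨ cong ⁺ (counts k) ⟩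
      ⁺ (#H k * (2 * k + 1))        ≡⟨ ℤP.pos-* (#H k) (2 * k + 1) ⟩
      ⁺ (#H k) ℤ.* odd k            ∎
    add-sub : ∀ a b → a ≡ a ℤ.+ b ℤ.- b
    add-sub = solve-∀
    factor-out : ∀ h x c → h ℤ.* x ℤ.- h ℤ.* c ≡ h ℤ.* (x ℤ.- c)
    factor-out = solve-∀

∨-true⁻ : ∀ {a b} → a ∨ b ≡ true → a ≡ true ⊎ b ≡ true
∨-true⁻ {true}  _   = inj₁ refl
∨-true⁻ {false} b≡t = inj₂ b≡t

∨-true⁺ : ∀ {a b} → a ≡ true → a ∨ b ≡ true
∨-true⁺ refl = refl

module CompleteLoopedThreshold {n} (G : SignedGraph (suc n)) (complete : Complete G) (loops : AllLoops G)
                               (threshold : Threshold (suc n) (neg G)) where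

  degNeg≡deg : ∀ x → degNeg G x ≡ deg (neg G) x
  degNeg≡deg x = sumOver-tabulate (suc n) (λ a → a) (λ u → ⟦ neg G x u ⟧)

  negative-nested : ∀ x y z → degNeg G x ≤ degNeg G y → neg G x z ≡ true → ¬ (z ≡ y) → neg G y z ≡ true
  negative-nested x y z le = nested (neg G) threshold (neg-sym G) (neg-irr G) x y z
                                    (subst₂ _≤_ (degNeg≡deg x) (degNeg≡deg y) le)

  MinimalNegDeg : Fin (suc n) → Set
  MinimalNegDeg v = ∀ u → degNeg G v ≤ degNeg G u

  -- (a) holds by completeness, (b) by nesting, (c) since all vertices have loops
  minimal⇒signed-simplicial : ∀ v → MinimalNegDeg v → SignedSimplicial G v
  minimal⇒signed-simplicial v v-min =
      (λ u₁ u₂ u₁≢u₂ _ → complete u₁ u₂ u₁≢u₂)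
    , (λ u₁ u₂ u₁≢u₂ _ u₂v → negative-nested v u₁ u₂ (v-min u₁) (trans (neg-sym G v u₂) u₂v) (u₁≢u₂ ∘ sym))
    , (λ u _ → loops u)

  -- Contracting the positive edge {v,w} at a vertex v of minimal negative
  -- degree: G/(v,w) is G − v, and each proper colouring of G − v extends
  -- to G in exactly 2k+1 − C ways, C = 1 + n + deg⁻ v.
  module ContractMinimal (v w : Fin (suc n)) (v-min : MinimalNegDeg v) (v≢w : ¬ (v ≡ w)) where

    H : SignedGraph n
    H = G /⁺ (v , w)

    private
      p : Fin n → Fin (suc n)
      p = punchIn v

    open Extension (neg G) (neg-sym G) (neg-irr G) v

    smallest-neighbourhood : SmallestNeighbourhood
    smallest-neighbourhood a b vb a≢b = negative-nested v (p a) (p b) (v-min (p a)) vb (a≢b ∘ sym ∘ punchIn-injective v b a)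

    -- a new negative edge {w,b} of H comes from an edge {v,b} of G, and is
    -- already in G by nesting (in all other cases `new` is false ≡ true)
    new-edge⁻ : ∀ a b → Contraction.new v w (neg G) a b ≡ true → neg G (p a) (p b) ≡ true
    new-edge⁻ a b new with p a ≟ w | p b ≟ w
    ... | yes refl | no pb≢w = negative-nested v (p a) (p b) (v-min (p a)) (∧-conicalʳ _ _ new) pb≢w

    H-complete : Complete H
    H-complete a b a≢b = ∨-true⁺ (complete (p a) (p b) (a≢b ∘ punchIn-injective v a b))

    H-loops : AllLoops H
    H-loops a = ∨-true⁺ (loops (p a))

    H-neg⁻ : ∀ a b → neg H a b ≡ true → (neg G without v) a b ≡ true
    H-neg⁻ a b ab with ∨-true⁻ ab
    ... | inj₁ old = old
    ... | inj₂ new with ∨-true⁻ new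
    ...   | inj₁ new-ab = new-edge⁻ a b new-ab
    ...   | inj₂ new-ba = trans (neg-sym G (p a) (p b)) (new-edge⁻ b a new-ba)

    proper-H⁻ : ∀ γ′ → proper H γ′ ≡ true → Valid (neg G without v) γ′
    proper-H⁻ γ′ ok = Valid-subgraph (λ a b ab → ∨-true⁺ ab) γ′ (proper⇒Valid H H-complete H-loops γ′ ok)

    proper-H⁺ : ∀ γ′ → Valid (neg G without v) γ′ → proper H γ′ ≡ true
    proper-H⁺ γ′ valid = Valid⇒proper H γ′ (Valid-subgraph H-neg⁻ γ′ valid)

    -- the number of forbidden colours
    C : ℕ
    C = suc (n + deg (neg G) v)

    #extensions : ℕ → Vec ℤ n → ℕ
    #extensions k γ′ = sumOver (Λ k) (λ c → ⟦ proper G (insertAt γ′ v c) ⟧)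

    extensions : ∀ k γ′ → γ′ ∈ colourings n k →
      #extensions k γ′ + ⟦ proper H γ′ ⟧ * C ≡ ⟦ proper H γ′ ⟧ * (2 * k + 1)
    extensions k γ′ γ′∈ with proper H γ′ in H-ok
    ... | false = trans (ℕP.+-identityʳ _)
                        (trans (sumOver-cong (Λ k) (λ c → cong ⟦_⟧ (no-extension c))) (sumOver-zero (Λ k)))
      where
      no-extension : ∀ c → proper G (insertAt γ′ v c) ≡ false
      no-extension c with proper G (insertAt γ′ v c) in G-ok
      ... | false = refl
      ... | true  = conflict (proper-H⁺ γ′ (proj₁ (Valid-insert⁻ γ′ c (proper⇒Valid G complete loops (insertAt γ′ v c) G-ok)))) H-ok
    ... | true = begin
      #extensions k γ′ + 1 * C ≡⟨ cong (#extensions k γ′ +_) (ℕP.*-identityˡ C) ⟩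
      #extensions k γ′ + C     ≡⟨ free-colours ⟩
      2 * k + 1                ≡⟨ ℕP.*-identityˡ (2 * k + 1) ⟨
      1 * (2 * k + 1)          ∎
      where
      valid : Valid (neg G without v) γ′
      valid = proper-H⁻ γ′ H-ok
      free-colours : #extensions k γ′ + C ≡ 2 * k + 1
      free-colours = count-free smallest-neighbourhood k γ′ valid (colourings-Λ n k γ′ γ′∈) (λ c → proper G (insertAt γ′ v c))
        (λ c → proj₂ ∘ Valid-insert⁻ γ′ c ∘ proper⇒Valid G complete loops (insertAt γ′ v c))
        (λ c → Valid⇒proper G (insertAt γ′ v c) ∘ Valid-insert⁺ γ′ c valid)

    counts : ∀ k → numColourings G k + numColourings H k * C ≡ numColourings H k * (2 * k + 1)
    counts k = begin
      numColourings G k + numColourings H k * C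
        ≡⟨ cong₂ _+_ (sumOver-colourings n k v (λ γ → ⟦ proper G γ ⟧))
                     (sym (sumOver-*ʳ (colourings n k) (λ γ′ → ⟦ proper H γ′ ⟧) C)) ⟩
      sumOver (colourings n k) (#extensions k) + sumOver (colourings n k) (λ γ′ → ⟦ proper H γ′ ⟧ * C)
        ≡⟨ sumOver-+ (colourings n k) (#extensions k) (λ γ′ → ⟦ proper H γ′ ⟧ * C) ⟨
      sumOver (colourings n k) (λ γ′ → #extensions k γ′ + ⟦ proper H γ′ ⟧ * C)
        ≡⟨ sumOver-cong∈ (colourings n k) (extensions k) ⟩
      sumOver (colourings n k) (λ γ′ → ⟦ proper H γ′ ⟧ * (2 * k + 1))
        ≡⟨ sumOver-*ʳ (colourings n k) (λ γ′ → ⟦ proper H γ′ ⟧) (2 * k + 1) ⟩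
      numColourings H k * (2 * k + 1) ∎

    divisional-edge : DivisionalEdge G v w
    divisional-edge = inj₁ (complete v w v≢w , chromatic-linear-factor G H C counts)

  open ContractMinimal using (divisional-edge)

  minimum : ∃ MinimalNegDeg
  minimum = u₀ , λ u → All.lookup (f[argmin]≤f[xs] {f = degNeg G} fzero (allFin (suc n))) (∈-allFin u)
    where
    u₀ : Fin (suc n)
    u₀ = argmin (degNeg G) fzero (allFin (suc n))

  divisional-around : ∀ u₀ → MinimalNegDeg u₀ → 1 ≤ n → ∀ v → DivisionalVertex G v
  divisional-around u₀ u₀-min 1≤n v with v ≟ u₀
  ... | no  v≢u₀ = u₀ , inj₂ (divisional-edge u₀ v u₀-min (v≢u₀ ∘ sym))
  ... | yes refl = w , inj₁ (divisional-edge v w u₀-min (punchInᵢ≢i v _ ∘ sym))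
    where
    w : Fin (suc n)
    w = punchIn v (fromℕ< 1≤n)

  every-vertex-divisional : 1 ≤ n → ∀ v → DivisionalVertex G v
  every-vertex-divisional = divisional-around (proj₁ minimum) (proj₂ minimum)

corollary6p4 : ∀ {n : ℕ} (G : SignedGraph (suc n)) →
    (∀ a b → ¬ (a ≡ b) → pos G a b ≡ true) →
    (∀ a → loop G a ≡ true) →
    Threshold (suc n) (neg G) →
    (∀ v → (∀ u → degNeg G v ≤ degNeg G u) → SignedSimplicial G v)
    × (1 ≤ n → ∀ v → DivisionalVertex G v)
corollary6p4 G complete loops threshold = minimal⇒signed-simplicial , every-vertex-divisional
  where open CompleteLoopedThreshold G complete loops threshold
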